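{- Let $t\ge 3$ be an odd integer and let $S=(1,1,2,2,\ldots)$, i.e. $a_1=a_2=1$ and $a_i=2$ for all $i\ge 3$. Then $\chi_S(G_t)=4$.
   Context: For an odd integer $t\ge 3$, $G_t$ denotes the integer distance graph $G(\mathbb{Z},\{2,t\})$: its vertex set is $\mathbb{Z}$, and distinct $i,j\in\mathbb{Z}$ are adjacent if and only if $|i-j|\in\{2,t\}$. For a graph $G$ and a non-decreasing sequence $S=(a_1,a_2,\ldots)$ of positive integers, an $S$-packing $k$-coloring of $G$ is a map $f:V(G)\to\{1,\ldots,k\}$ such that any two distinct vertices $u,v$ with $f(u)=f(v)=i$ satisfy $d_G(u,v)>a_i$, where $d_G$ is the shortest-path distance. The $S$-packing chromatic number $\chi_S(G)$ is the smallest $k$ for which $G$ has an $S$-packing $k$-coloring. -}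

module Defs where

open import Data.Nat using (ℕ; zero; suc; _≤_; _<_; _≤ᵇ_)
open import Data.Integer using (ℤ; ∣_∣; _-_)
open import Data.Fin using (Fin; toℕ)
open import Data.Sum using (_⊎_)
open import Data.Product using (Σ; ∃; _×_)
open import Data.Bool using (if_then_else_)
open import Relation.Nullary using (¬_)
open import Relation.Binary.PropositionalEquality using (_≡_; _≢_)

-- Reach Adj k u v : there is a walk from u to v with at most k edges,
-- i.e. d_G(u,v) ≤ k.  Hence d_G(u,v) > k  iff  ¬ Reach Adj k u v.
data Reach {V : Set} (Adj : V → V → Set) : ℕ → V → V → Set where
  here  : ∀ {k u} → Reach Adj k u u
  step  : ∀ {k u w v} → Adj u w → Reach Adj k w v → Reach Adj (suc k) u v

-- S-packing k-coloring: colours are Fin k, colour c stands for the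
-- paper's colour (toℕ c + 1), and the sequence S is indexed from 1:
-- S 1 = a₁, S 2 = a₂, ...
IsSPackingColoring : {V : Set} (Adj : V → V → Set) (S : ℕ → ℕ) (k : ℕ) →
                     (V → Fin k) → Set
IsSPackingColoring {V} Adj S k f =
  ∀ (u v : V) → u ≢ v → f u ≡ f v → ¬ Reach Adj (S (suc (toℕ (f u)))) u v

HasSPackingColoring : {V : Set} (Adj : V → V → Set) (S : ℕ → ℕ) (k : ℕ) → Set
HasSPackingColoring {V} Adj S k = Σ (V → Fin k) (IsSPackingColoring Adj S k)

SPackingChromaticNumberIs : {V : Set} (Adj : V → V → Set) (S : ℕ → ℕ) (n : ℕ) → Set
SPackingChromaticNumberIs Adj S n =
  HasSPackingColoring Adj S n × (∀ k → k < n → ¬ HasSPackingColoring Adj S k)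

DistAdj : ℕ → ℤ → ℤ → Set
DistAdj t i j = i ≢ j × (∣ i - j ∣ ≡ 2 ⊎ ∣ i - j ∣ ≡ t)

-- S = (1,1,2,2,2,...), indexed from 1 (S 0 is irrelevant).
S₁₁₂ : ℕ → ℕ
S₁₁₂ i = if i ≤ᵇ 2 then 1 else 2

-- In an S-packing colouring with three colours, read the two colours
-- of packing distance 1 as a bit on the remaining ("light") vertices.  Adjacent light
-- vertices carry opposite bits, and since the third colour is a 2-packing, every
-- vertex of that colour at y + 2 is bypassed by a light four-edge detour
-- y, y + t, y + 2 + t, y + 4 + t, y + 4.  Hence along every progression x, x + 2, ...
-- the bit of a light vertex x + 2j is the bit of x flipped j times.  Going from a
-- light t-edge (a, a + t) to a light t-edge (b, b + t) with b = a + t + 2e, the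
-- vertex b + t is reached from a both by t + e such steps and, via the two t-edges,
-- by e steps and two flips; for odd t the two parities disagree.
--
-- Equal colours must avoid the differences 2 and t realised by edges,
-- and colours 3 and 4 also the differences 4, 2t, t + 2 and t - 2 realised by walks
-- of length two.  For a colouring that is periodic modulo 16 this is a finite
-- condition on one period, which is checked by evaluation for a pattern chosen
-- according to t mod 16.
module Submission where

open import Defs
open import Data.Nat using (ℕ; _≤_)
open import Data.Nat.Divisibility using (_∣_)
open import Relation.Nullary using (¬_)

open import Algebra.Properties.CommutativeSemigroup using (xy∙z≈xz∙y)
open import Data.Bool using (Bool; true; false; not)
open import Data.Bool.Properties using (not-involutive; not-¬)
open import Data.Empty using (⊥)
open import Data.Fin using (Fin; zero; suc; toℕ; fromℕ<; inject≤; #_)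
open import Data.Fin.Properties
  using (_≟_; all?; toℕ-injective; toℕ-fromℕ<; toℕ-inject≤)
open import Data.Integer as ℤ using (ℤ; +_; -[1+_]; ∣_∣; _-_; _⊖_)
import Data.Integer.Properties as ℤ
import Data.Integer.Tactic.RingSolver as ℤ-Solver
open import Data.Nat as ℕ
  using (zero; suc; _+_; _*_; _∸_; _<_; _%_; _/_; _<?_; NonZero; s≤s; z≤n)
open import Data.Nat.DivMod
  using ( _mod_; m%n<n; m%n%n≡m%n; m<n⇒m%n≡m; %-distribˡ-+; [m+n]%n≡m%n
        ; [m+kn]%n≡m%n; n%n≡0; m≡m%n+[m/n]*n; m∣n⇒o%n%m≡o%m)
open import Data.Nat.Divisibility using (divides; m%n≡0⇒n∣m)
open import Data.Nat.GeneralisedArithmetic using (iterate)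
open import Data.Nat.Properties
  using ( +-identityʳ; +-assoc; +-comm; +-suc; +-cancelˡ-≡; +-commutativeSemigroup
        ; ≤-pred; ≤-trans; <⇒≤; <-irrefl; m≤m+n; m+n∸m≡n; m+n≮m; m∸n+n≡m; m+1+n≢m)
open import Data.Nat.Tactic.RingSolver using (solve-∀)
open import Data.Product using (∃-syntax; _×_; _,_; proj₁)
open import Data.Sum using (_⊎_; inj₁; inj₂; [_,_]′)
open import Data.Vec using (Vec; []; _∷_; lookup)
open import Function using (_∘_)
open import Relation.Nullary using (Dec; yes; no; contradiction)
open import Relation.Nullary.Decidable using (_×-dec_; _→-dec_; from-yes)
open import Relation.Binary.PropositionalEquality

+-right-comm : ∀ m n o → m + n + o ≡ m + o + n
+-right-comm = xy∙z≈xz∙y +-commutativeSemigroup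

reach-one : ∀ {V : Set} {A : V → V → Set} {u v} → Reach A 1 u v → u ≢ v → A u v
reach-one here           u≢v = contradiction refl u≢v
reach-one (step uv here) _   = uv

reach-two : ∀ {V : Set} {A : V → V → Set} {u v} → Reach A 2 u v → u ≢ v →
            A u v ⊎ ∃[ w ] A u w × A w v
reach-two here                     u≢v = contradiction refl u≢v
reach-two (step uv here)           _   = inj₁ uv
reach-two (step uw (step wv here)) _   = inj₂ (_ , uw , wv)

S₁₁₂-reaches-neighbours : ∀ {V : Set} {A : V → V → Set} {u v} n → A u v →
                          Reach A (S₁₁₂ n) u v
S₁₁₂-reaches-neighbours n uv with n ℕ.≤ᵇ 2
... | true  = step uv here
... | false = step uv here

-- Three colours do not suffice

bit : Fin 3 → Bool
bit (suc zero) = true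
bit _          = false

bit-flips : ∀ (i j : Fin 3) → i ≢ j → i ≢ # 2 → j ≢ # 2 → bit j ≡ not (bit i)
bit-flips zero             zero             i≢j _   _   = contradiction refl i≢j
bit-flips zero             (suc zero)       _   _   _   = refl
bit-flips (suc zero)       zero             _   _   _   = refl
bit-flips (suc zero)       (suc zero)       i≢j _   _   = contradiction refl i≢j
bit-flips (suc (suc zero)) _                _   i≢2 _   = contradiction refl i≢2
bit-flips _                (suc (suc zero)) _   _   j≢2 = contradiction refl j≢2

not-swap : ∀ {a b} → b ≡ not a → a ≡ not b
not-swap {a} refl = sym (not-involutive a)

iterate-not-even : ∀ h n b → iterate not b (h * 2 + n) ≡ iterate not b n
iterate-not-even zero    n b = refl
iterate-not-even (suc h) n b =
  trans (cong (λ b′ → iterate not b′ (h * 2 + n)) (not-involutive b)) (iterate-not-even h n b)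

-- Colour # 2 is the one of packing distance 2; sparse₊ and sparse₋ forbid it at both
-- ends of the walks x, x + 2, x + 2 + t and x + 2, x + 2 + t, x + t.
module ThreeColouring
    (t : ℕ) (c : ℕ → Fin 3)
    (proper₂ : ∀ x → c x ≢ c (x + 2))
    (properₜ : ∀ x → c x ≢ c (x + t))
    (sparse₊ : ∀ x → c x ≡ # 2 → c (x + 2 + t) ≢ # 2)
    (sparse₋ : ∀ x → c (x + 2) ≡ # 2 → c (x + t) ≢ # 2)
  where

  Light : ℕ → Set
  Light x = c x ≢ # 2

  light-or-heavy : ∀ x → Light x ⊎ c x ≡ # 2
  light-or-heavy x with c x ≟ # 2
  ... | yes heavy = inj₂ heavy
  ... | no light  = inj₁ light

  light-beside : ∀ {x y} → c x ≡ # 2 → c x ≢ c y → Light y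
  light-beside heavy x≢y y-heavy = x≢y (trans heavy (sym y-heavy))

  bitAt : ℕ → Bool
  bitAt x = bit (c x)

  flip₂ : ∀ {a b} → b ≡ a + 2 → Light a → Light b → bitAt b ≡ not (bitAt a)
  flip₂ {a} refl = bit-flips (c a) (c (a + 2)) (proper₂ a)

  flipₜ : ∀ {a b} → b ≡ a + t → Light a → Light b → bitAt b ≡ not (bitAt a)
  flipₜ {a} refl = bit-flips (c a) (c (a + t)) (properₜ a)

  bit-across-heavy : ∀ y → c (y + 2) ≡ # 2 → bitAt (y + 2 + 2) ≡ bitAt y
  bit-across-heavy y heavy = begin
    bitAt (y + 2 + 2)             ≡⟨ not-swap (flipₜ refl L₄ L₄ₜ) ⟩
    not (bitAt (y + 2 + 2 + t))   ≡⟨ cong not (flip₂ (+-right-comm (y + 2) 2 t) L₂ₜ L₄ₜ) ⟩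
    not (not (bitAt (y + 2 + t))) ≡⟨ not-involutive _ ⟩
    bitAt (y + 2 + t)             ≡⟨ flip₂ (+-right-comm y 2 t) Lₜ L₂ₜ ⟩
    not (bitAt (y + t))           ≡⟨ cong not (flipₜ refl L₀ Lₜ) ⟩
    not (not (bitAt y))           ≡⟨ not-involutive _ ⟩
    bitAt y                       ∎
    where
    open ≡-Reasoning
    L₀ : Light y
    L₀ y-heavy = proper₂ y (trans y-heavy (sym heavy))
    L₄ : Light (y + 2 + 2)
    L₄ = light-beside heavy (proper₂ (y + 2))
    Lₜ : Light (y + t)
    Lₜ = sparse₋ y heavy
    L₂ₜ : Light (y + 2 + t)
    L₂ₜ = light-beside heavy (properₜ (y + 2))
    L₄ₜ : Light (y + 2 + 2 + t)
    L₄ₜ = sparse₊ (y + 2) heavy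

  bit-alternates : ∀ j {x y} → y ≡ x + j * 2 → Light x → Light y →
                   bitAt y ≡ iterate not (bitAt x) j
  bit-alternates zero          {x} refl _  _  = cong bitAt (+-identityʳ x)
  bit-alternates (suc zero)    y≡      Lx Ly = flip₂ y≡ Lx Ly
  bit-alternates (suc (suc j)) {x} y≡  Lx Ly =
    [ (λ L₂ → trans (bit-alternates (suc j) (trans y≡ (sym (+-assoc x 2 _))) L₂ Ly)
                    (cong (λ b → iterate not b (suc j)) (flip₂ refl Lx L₂)))
    , (λ heavy → trans (bit-alternates j (trans y≡ (sym (trans (+-assoc (x + 2) 2 _) (+-assoc x 2 _))))
                                         (light-beside heavy (proper₂ (x + 2))) Ly)
                       (cong (λ b → iterate not b j)
                             (trans (bit-across-heavy x heavy) (sym (not-involutive _)))))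
    ]′ (light-or-heavy (x + 2))

  light-t-edge : ∀ y → ∃[ a ] ∃[ e ] a ≡ y + e * 2 × Light a × Light (a + t)
  light-t-edge y with light-or-heavy y | light-or-heavy (y + t)
  ... | inj₁ Ly    | inj₁ Lyt  = y , 0 , sym (+-identityʳ y) , Ly , Lyt
  ... | inj₂ heavy | _         = y + 2 , 1 , refl , light-beside heavy (proper₂ y) , sparse₊ y heavy
  ... | inj₁ _     | inj₂ heavy =
    y + 2 , 1 , refl , (λ heavy₂ → sparse₋ y heavy₂ heavy) ,
    subst Light (sym (+-right-comm y 2 t)) (light-beside heavy (proper₂ (y + t)))

  no-colouring : ∀ h → t ≡ suc (h * 2) → ⊥
  no-colouring h t≡ with light-t-edge 0
  ... | a , _ , _ , La , Lat with light-t-edge (a + t)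
  ... | b , e , b≡ , Lb , Lbt = not-¬ refl (trans (sym via-a) via-b)
    where
    open ≡-Reasoning
    regroup : ∀ a t e → a + t + e * 2 + t ≡ a + (t + e) * 2
    regroup = solve-∀
    b+t≡a+[t+e]*2 : b + t ≡ a + (t + e) * 2
    b+t≡a+[t+e]*2 = trans (cong (_+ t) b≡) (regroup a t e)
    via-a : bitAt (b + t) ≡ iterate not (not (bitAt a)) e
    via-a = begin
      bitAt (b + t)                           ≡⟨ bit-alternates (t + e) b+t≡a+[t+e]*2 La Lbt ⟩
      iterate not (bitAt a) (t + e)           ≡⟨ cong (λ n → iterate not (bitAt a) (n + e)) t≡ ⟩
      iterate not (not (bitAt a)) (h * 2 + e) ≡⟨ iterate-not-even h e _ ⟩
      iterate not (not (bitAt a)) e           ∎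
    via-b : bitAt (b + t) ≡ not (iterate not (not (bitAt a)) e)
    via-b = begin
      bitAt (b + t)                         ≡⟨ flipₜ refl Lb Lbt ⟩
      not (bitAt b)                         ≡⟨ cong not (bit-alternates e b≡ Lat Lb) ⟩
      not (iterate not (bitAt (a + t)) e)   ≡⟨ cong (λ x → not (iterate not x e)) (flipₜ refl La Lat) ⟩
      not (iterate not (not (bitAt a)) e)   ∎

odd-remainder : ∀ {t} → ¬ 2 ∣ t → t % 2 ≡ 1
odd-remainder {t} t-odd with t % 2 in t%2≡ | m%n<n t 2
... | 0           | _            = contradiction (m%n≡0⇒n∣m t 2 t%2≡) t-odd
... | 1           | _            = refl
... | suc (suc _) | s≤s (s≤s ())

odd-form : ∀ {t} → ¬ 2 ∣ t → t ≡ suc (t / 2 * 2)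
odd-form {t} t-odd = trans (m≡m%n+[m/n]*n t 2) (cong (_+ t / 2 * 2) (odd-remainder t-odd))

∣m-[m+n]∣≡n : ∀ m n → ∣ + m - + (m + n) ∣ ≡ n
∣m-[m+n]∣≡n m n =
  trans (cong ∣_∣ (ℤ.m-n≡m⊖n m (m + n))) (trans (ℤ.∣⊖∣-≤ (m≤m+n m n)) (m+n∸m≡n m n))

+m≢+[m+n] : ∀ m {n} → 0 < n → + m ≢ + (m + n)
+m≢+[m+n] m (s≤s _) eq = m+1+n≢m m (sym (ℤ.+-injective eq))

forward-adjacent : ∀ {t} m {n} → 0 < n → n ≡ 2 ⊎ n ≡ t → DistAdj t (+ m) (+ (m + n))
forward-adjacent {t} m {n} 0<n gap =
  +m≢+[m+n] m 0<n , subst (λ d → d ≡ 2 ⊎ d ≡ t) (sym (∣m-[m+n]∣≡n m n)) gap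

DistAdj-sym : ∀ {t u v} → DistAdj t u v → DistAdj t v u
DistAdj-sym {t} {u} {v} (u≢v , gap) =
  u≢v ∘ sym , subst (λ d → d ≡ 2 ⊎ d ≡ t) (ℤ.∣i-j∣≡∣j-i∣ u v) gap

module RestrictionToℕ
    {t k} (3≤t : 3 ≤ t) (k≤3 : k ≤ 3)
    (f : ℤ → Fin k) (packing : IsSPackingColoring (DistAdj t) S₁₁₂ k f)
  where

  c : ℕ → Fin 3
  c n = inject≤ (f (+ n)) k≤3

  toℕ-c : ∀ n → toℕ (c n) ≡ toℕ (f (+ n))
  toℕ-c n = toℕ-inject≤ (f (+ n)) k≤3

  same-colour : ∀ {x y} → c x ≡ c y → f (+ x) ≡ f (+ y)
  same-colour {x} {y} eq = toℕ-injective (trans (sym (toℕ-c x)) (trans (cong toℕ eq) (toℕ-c y)))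

  proper : ∀ {x y} → DistAdj t (+ x) (+ y) → c x ≢ c y
  proper {x} xy eq =
    packing _ _ (proj₁ xy) (same-colour eq) (S₁₁₂-reaches-neighbours (suc (toℕ (f (+ x)))) xy)

  sparse : ∀ {x y z} → + x ≢ + z → DistAdj t (+ x) (+ y) → DistAdj t (+ y) (+ z) →
           c x ≡ # 2 → c z ≢ # 2
  sparse {x} x≢z xy yz cx≡2 cz≡2 =
    packing _ _ x≢z (same-colour (trans cx≡2 (sym cz≡2)))
      (subst (λ i → Reach (DistAdj t) (S₁₁₂ (suc i)) _ _)
             (trans (sym (cong toℕ cx≡2)) (toℕ-c x))
             (step xy (step yz here)))

  0<t : 0 < t
  0<t = ≤-trans (s≤s z≤n) 3≤t

  proper₂ : ∀ x → c x ≢ c (x + 2)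
  proper₂ x = proper (forward-adjacent x (s≤s z≤n) (inj₁ refl))

  properₜ : ∀ x → c x ≢ c (x + t)
  properₜ x = proper (forward-adjacent x 0<t (inj₂ refl))

  sparse₊ : ∀ x → c x ≡ # 2 → c (x + 2 + t) ≢ # 2
  sparse₊ x = sparse (λ eq → +m≢+[m+n] x (s≤s z≤n) (trans eq (cong +_ (+-assoc x 2 t))))
                     (forward-adjacent x (s≤s z≤n) (inj₁ refl))
                     (forward-adjacent (x + 2) 0<t (inj₂ refl))

  sparse₋ : ∀ x → c (x + 2) ≡ # 2 → c (x + t) ≢ # 2
  sparse₋ x = sparse (λ eq → <-irrefl (+-cancelˡ-≡ x 2 t (ℤ.+-injective eq)) 3≤t)
                     (forward-adjacent (x + 2) 0<t (inj₂ refl))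
                     (subst (λ y → DistAdj t (+ y) (+ (x + t))) (+-right-comm x t 2)
                            (DistAdj-sym (forward-adjacent (x + t) (s≤s z≤n) (inj₁ refl))))

no-packing-below-four : ∀ t → 3 ≤ t → ¬ 2 ∣ t → ∀ k → k < 4 →
                        ¬ HasSPackingColoring (DistAdj t) S₁₁₂ k
no-packing-below-four t 3≤t t-odd k k<4 (f , packing) =
  ThreeColouring.no-colouring t c proper₂ properₜ sparse₊ sparse₋ (t / 2) (odd-form t-odd)
  where open RestrictionToℕ 3≤t (≤-pred k<4) f packing

∣i+j∣-cases : ∀ i j → ∣ i ℤ.+ j ∣ ≡ ∣ i ∣ + ∣ j ∣ ⊎ ∣ i ℤ.+ j ∣ ≡ ∣ ∣ i ∣ ⊖ ∣ j ∣ ∣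
∣i+j∣-cases (+ m)    (+ n)    = inj₁ refl
∣i+j∣-cases (+ m)    -[1+ n ] = inj₂ refl
∣i+j∣-cases -[1+ m ] (+ n)    = inj₂ (ℤ.∣m⊖n∣≡∣n⊖m∣ n (suc m))
∣i+j∣-cases -[1+ m ] -[1+ n ] = inj₁ (cong suc (sym (+-suc m n)))

data TwoStepGap (t : ℕ) : ℕ → Set where
  2+2 : TwoStepGap t 4
  t+t : TwoStepGap t (t + t)
  t+2 : TwoStepGap t (t + 2)
  t-2 : TwoStepGap t (t ∸ 2)

two-step-gap-cases : ∀ {t m n d} → 2 ≤ t → m ≡ 2 ⊎ m ≡ t → n ≡ 2 ⊎ n ≡ t →
                     d ≡ m + n ⊎ d ≡ ∣ m ⊖ n ∣ → d ≡ 0 ⊎ TwoStepGap t d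
two-step-gap-cases     _   (inj₁ refl) (inj₁ refl) (inj₁ refl) = inj₂ 2+2
two-step-gap-cases {t} _   (inj₁ refl) (inj₂ refl) (inj₁ refl) =
  inj₂ (subst (TwoStepGap t) (+-comm t 2) t+2)
two-step-gap-cases     _   (inj₂ refl) (inj₁ refl) (inj₁ refl) = inj₂ t+2
two-step-gap-cases     _   (inj₂ refl) (inj₂ refl) (inj₁ refl) = inj₂ t+t
two-step-gap-cases     _   (inj₁ refl) (inj₁ refl) (inj₂ refl) = inj₁ refl
two-step-gap-cases {t} 2≤t (inj₁ refl) (inj₂ refl) (inj₂ refl) =
  inj₂ (subst (TwoStepGap t) (sym (ℤ.∣⊖∣-≤ 2≤t)) t-2)
two-step-gap-cases {t} 2≤t (inj₂ refl) (inj₁ refl) (inj₂ refl) =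
  inj₂ (subst (TwoStepGap t) (sym (trans (ℤ.∣m⊖n∣≡∣n⊖m∣ t 2) (ℤ.∣⊖∣-≤ 2≤t))) t-2)
two-step-gap-cases {t} _   (inj₂ refl) (inj₂ refl) (inj₂ refl) = inj₁ (cong ∣_∣ (ℤ.n⊖n≡0 t))

two-step-gap : ∀ {t u w v} → 2 ≤ t → DistAdj t u w → DistAdj t w v → u ≢ v →
               TwoStepGap t ∣ u - v ∣
two-step-gap {t} {u} {w} {v} 2≤t (_ , uw) (_ , wv) u≢v =
  [ (λ no-gap → contradiction (ℤ.i-j≡0⇒i≡j u v (ℤ.∣i∣≡0⇒i≡0 no-gap)) u≢v) , (λ gap → gap) ]′
    (two-step-gap-cases 2≤t uw wv
      (subst (λ d → d ≡ ∣ u - w ∣ + ∣ w - v ∣ ⊎ d ≡ ∣ ∣ u - w ∣ ⊖ ∣ w - v ∣ ∣)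
             (cong ∣_∣ (ℤ.+-minus-telescope u w v)) (∣i+j∣-cases (u - w) (w - v))))

AvoidsGap : ∀ {k} → (ℤ → Fin k) → (Fin k → Set) → ℕ → Set
AvoidsGap f Exempt d = ∀ u v → ∣ u - v ∣ ≡ d → f u ≡ f v → Exempt (f u)

Never : ∀ {k} → Fin k → Set
Never _ = ⊥

Light : ∀ {k} → Fin k → Set
Light i = toℕ i < 2

packing-from-gaps : ∀ {t} → 2 ≤ t → (f : ℤ → Fin 4) →
                    AvoidsGap f Never 2 → AvoidsGap f Never t →
                    (∀ {d} → TwoStepGap t d → AvoidsGap f Light d) →
                    IsSPackingColoring (DistAdj t) S₁₁₂ 4 f
packing-from-gaps {t} 2≤t f avoids₂ avoidsₜ avoids-two-step u v u≢v same =
  by-colour (f u) refl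
  where
  not-adjacent : ¬ DistAdj t u v
  not-adjacent (_ , inj₁ gap) = avoids₂ u v gap same
  not-adjacent (_ , inj₂ gap) = avoidsₜ u v gap same

  not-two-steps : ∀ i → f u ≡ suc (suc i) → ¬ (∃[ w ] DistAdj t u w × DistAdj t w v)
  not-two-steps i fu≡ (_ , uw , wv) =
    m+n≮m 2 (toℕ i)
          (subst Light fu≡ (avoids-two-step (two-step-gap 2≤t uw wv u≢v) u v refl same))

  by-colour : ∀ i → f u ≡ i → ¬ Reach (DistAdj t) (S₁₁₂ (suc (toℕ i))) u v
  by-colour zero          _   walk = not-adjacent (reach-one walk u≢v)
  by-colour (suc zero)    _   walk = not-adjacent (reach-one walk u≢v)
  by-colour (suc (suc i)) fu≡ walk =
    [ not-adjacent , not-two-steps i fu≡ ]′ (reach-two walk u≢v)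

-- Periodic colourings

[m%n+o]%n≡[m+o]%n : ∀ m o n .{{_ : NonZero n}} → (m % n + o) % n ≡ (m + o) % n
[m%n+o]%n≡[m+o]%n m o n = begin
  (m % n + o) % n         ≡⟨ %-distribˡ-+ (m % n) o n ⟩
  (m % n % n + o % n) % n ≡⟨ cong (λ x → (x + o % n) % n) (m%n%n≡m%n m n) ⟩
  (m % n + o % n) % n     ≡⟨ %-distribˡ-+ m o n ⟨
  (m + o) % n             ∎
  where open ≡-Reasoning

%-cong-+ : ∀ m m′ o o′ n .{{_ : NonZero n}} → m % n ≡ m′ % n → o % n ≡ o′ % n →
           (m + o) % n ≡ (m′ + o′) % n
%-cong-+ m m′ o o′ n m≡m′ o≡o′ = begin
  (m + o) % n           ≡⟨ %-distribˡ-+ m o n ⟩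
  (m % n + o % n) % n   ≡⟨ cong₂ (λ x y → (x + y) % n) m≡m′ o≡o′ ⟩
  (m′ % n + o′ % n) % n ≡⟨ %-distribˡ-+ m′ o′ n ⟨
  (m′ + o′) % n         ∎
  where open ≡-Reasoning

-- -[1+ n ] is sent to (p - 1)(n + 1), which is congruent to -(n + 1) modulo p.
residue : (p : ℕ) .{{_ : NonZero p}} → ℤ → ℕ
residue p (+ n)    = n % p
residue p -[1+ n ] = (p ∸ 1) * suc n % p

residue<p : ∀ p .{{_ : NonZero p}} u → residue p u < p
residue<p p (+ n)    = m%n<n n p
residue<p p -[1+ n ] = m%n<n ((p ∸ 1) * suc n) p

residue-+1 : ∀ p .{{_ : NonZero p}} u → residue p (u ℤ.+ + 1) ≡ (residue p u + 1) % p
residue-+1 p       (+ n)          = sym ([m%n+o]%n≡[m+o]%n n 1 p)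
residue-+1 (suc q) -[1+ zero ]    = sym (begin
  (q * 1 % suc q + 1) % suc q ≡⟨ [m%n+o]%n≡[m+o]%n (q * 1) 1 (suc q) ⟩
  (q * 1 + 1) % suc q         ≡⟨ cong (_% suc q) (q*1+1≡1+q q) ⟩
  suc q % suc q               ≡⟨ n%n≡0 (suc q) ⟩
  0                           ∎)
  where
  open ≡-Reasoning
  q*1+1≡1+q : ∀ q → q * 1 + 1 ≡ suc q
  q*1+1≡1+q = solve-∀
residue-+1 (suc q) -[1+ suc n ]   = sym (begin
  (q * suc (suc n) % suc q + 1) % suc q ≡⟨ [m%n+o]%n≡[m+o]%n (q * suc (suc n)) 1 (suc q) ⟩
  (q * suc (suc n) + 1) % suc q         ≡⟨ cong (_% suc q) (regroup q n) ⟩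
  (q * suc n + 1 * suc q) % suc q       ≡⟨ [m+kn]%n≡m%n (q * suc n) 1 (suc q) ⟩
  q * suc n % suc q                     ∎)
  where
  open ≡-Reasoning
  regroup : ∀ q n → q * suc (suc n) + 1 ≡ q * suc n + 1 * suc q
  regroup = solve-∀

residue-+ : ∀ p .{{_ : NonZero p}} u n → residue p (u ℤ.+ + n) ≡ (residue p u + n) % p
residue-+ p u zero    = begin
  residue p (u ℤ.+ + 0)  ≡⟨ cong (residue p) (ℤ.+-identityʳ u) ⟩
  residue p u            ≡⟨ m<n⇒m%n≡m (residue<p p u) ⟨
  residue p u % p        ≡⟨ cong (_% p) (+-identityʳ (residue p u)) ⟨
  (residue p u + 0) % p  ∎
  where open ≡-Reasoning
residue-+ p u (suc n) = begin
  residue p (u ℤ.+ + suc n)        ≡⟨ cong (residue p) (ℤ.+-assoc u (+ 1) (+ n)) ⟨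
  residue p (u ℤ.+ + 1 ℤ.+ + n)    ≡⟨ residue-+ p (u ℤ.+ + 1) n ⟩
  (residue p (u ℤ.+ + 1) + n) % p  ≡⟨ cong (λ r → (r + n) % p) (residue-+1 p u) ⟩
  ((residue p u + 1) % p + n) % p  ≡⟨ [m%n+o]%n≡[m+o]%n (residue p u + 1) n p ⟩
  (residue p u + 1 + n) % p        ≡⟨ cong (_% p) (+-assoc (residue p u) 1 n) ⟩
  (residue p u + suc n) % p        ∎
  where open ≡-Reasoning

residue-of-gap : ∀ p .{{_ : NonZero p}} u v {d} → ∣ u - v ∣ ≡ d →
                 residue p v ≡ (residue p u + d) % p ⊎ residue p u ≡ (residue p v + d) % p
residue-of-gap p u v refl with ℤ.+∣i∣≡i⊎+∣i∣≡-i (u - v)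
... | inj₁ +∣u-v∣≡u-v  =
  inj₂ (trans (cong (residue p) (trans (u≡v+[u-v] u v) (cong (λ i → v ℤ.+ i) (sym +∣u-v∣≡u-v))))
              (residue-+ p v ∣ u - v ∣))
  where
  u≡v+[u-v] : ∀ u v → u ≡ v ℤ.+ (u - v)
  u≡v+[u-v] = ℤ-Solver.solve-∀
... | inj₂ +∣u-v∣≡-[u-v] =
  inj₁ (trans (cong (residue p) (trans (v≡u-[u-v] u v) (cong (λ i → u ℤ.+ i) (sym +∣u-v∣≡-[u-v]))))
              (residue-+ p u ∣ u - v ∣))
  where
  v≡u-[u-v] : ∀ u v → v ≡ u ℤ.+ ℤ.- (u - v)
  v≡u-[u-v] = ℤ-Solver.solve-∀

module Periodic (p : ℕ) .{{_ : NonZero p}} {k} (P : ℕ → Fin k) where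

  colouring : ℤ → Fin k
  colouring u = P (residue p u)

  AvoidsResidueGap : (Fin k → Set) → ℕ → Set
  AvoidsResidueGap Exempt e =
    ∀ (a : Fin p) → P (toℕ a) ≡ P ((toℕ a + e) % p) → Exempt (P (toℕ a))

  avoidsResidueGap? : ∀ {Exempt} → (∀ i → Dec (Exempt i)) → ∀ e →
                      Dec (AvoidsResidueGap Exempt e)
  avoidsResidueGap? exempt? e =
    all? λ a → (P (toℕ a) ≟ P ((toℕ a + e) % p)) →-dec exempt? (P (toℕ a))

  at-residue : ∀ {Exempt e} → AvoidsResidueGap Exempt e → ∀ u →
               colouring u ≡ P ((residue p u + e) % p) → Exempt (colouring u)
  at-residue {Exempt} {e} avoids u =
    subst (λ r → P r ≡ P ((r + e) % p) → Exempt (P r)) (toℕ-fromℕ< (residue<p p u))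
          (avoids (fromℕ< (residue<p p u)))

  avoids-gap : ∀ Exempt {d e} → d % p ≡ e % p → AvoidsResidueGap Exempt e →
               AvoidsGap colouring Exempt d
  avoids-gap Exempt {d} {e} d≡e avoids u v gap same with residue-of-gap p u v gap
  ... | inj₁ v≡ =
    at-residue {Exempt} avoids u (trans same (cong P (trans v≡ (%-cong-+ _ _ d e p refl d≡e))))
  ... | inj₂ u≡ = subst Exempt (sym same)
    (at-residue {Exempt} avoids v (trans (sym same) (cong P (trans u≡ (%-cong-+ _ _ d e p refl d≡e)))))

-- Four colours suffice

-- Indexed by t mod 16.  The differences for r and 16 - r agree modulo 16 up to sign,
-- so the residues r and 16 - r share a pattern; the last clause serves 7 and 9 (even
-- residues never occur).
pattern-mod-16 : ℕ → Vec (Fin 4) 16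
pattern-mod-16 1  = # 0 ∷ # 1 ∷ # 2 ∷ # 0 ∷ # 1 ∷ # 3 ∷ # 0 ∷ # 1
                  ∷ # 2 ∷ # 0 ∷ # 3 ∷ # 1 ∷ # 0 ∷ # 2 ∷ # 1 ∷ # 3 ∷ []
pattern-mod-16 15 = pattern-mod-16 1
pattern-mod-16 3  = # 0 ∷ # 0 ∷ # 1 ∷ # 1 ∷ # 2 ∷ # 0 ∷ # 0 ∷ # 3
                  ∷ # 1 ∷ # 1 ∷ # 0 ∷ # 0 ∷ # 2 ∷ # 1 ∷ # 1 ∷ # 3 ∷ []
pattern-mod-16 13 = pattern-mod-16 3
pattern-mod-16 5  = # 0 ∷ # 0 ∷ # 1 ∷ # 2 ∷ # 0 ∷ # 1 ∷ # 3 ∷ # 0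
                  ∷ # 1 ∷ # 1 ∷ # 0 ∷ # 2 ∷ # 1 ∷ # 0 ∷ # 3 ∷ # 1 ∷ []
pattern-mod-16 11 = pattern-mod-16 5
pattern-mod-16 _  = # 0 ∷ # 0 ∷ # 1 ∷ # 1 ∷ # 2 ∷ # 0 ∷ # 0 ∷ # 2
                  ∷ # 1 ∷ # 3 ∷ # 2 ∷ # 0 ∷ # 3 ∷ # 1 ∷ # 1 ∷ # 3 ∷ []

pattern-colour : ℕ → ℕ → Fin 4
pattern-colour r x = lookup (pattern-mod-16 r) (x mod 16)

-- r + 14 stands for t - 2 modulo 16 (r - 2 would truncate at r = 1).
ValidPattern : ℕ → Set
ValidPattern r =
  AvoidsResidueGap Never 2 × AvoidsResidueGap Never r ×
  AvoidsResidueGap Light 4 × AvoidsResidueGap Light (r + r) ×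
  AvoidsResidueGap Light (r + 2) × AvoidsResidueGap Light (r + 14)
  where open Periodic 16 (pattern-colour r)

validPattern? : ∀ r → Dec (ValidPattern r)
validPattern? r =
  avoidsResidueGap? never? 2 ×-dec avoidsResidueGap? never? r ×-dec
  avoidsResidueGap? light? 4 ×-dec avoidsResidueGap? light? (r + r) ×-dec
  avoidsResidueGap? light? (r + 2) ×-dec avoidsResidueGap? light? (r + 14)
  where
  open Periodic 16 (pattern-colour r)
  never? : ∀ i → Dec (Never i)
  never? _ = no λ ()
  light? : ∀ i → Dec (Light i)
  light? i = toℕ i <? 2

OddResiduesValid : Set
OddResiduesValid = ∀ (r : Fin 16) → toℕ r % 2 ≡ 1 → ValidPattern (toℕ r)

oddResiduesValid? : Dec OddResiduesValid
oddResiduesValid? = all? λ r → (toℕ r % 2 ℕ.≟ 1) →-dec validPattern? (toℕ r)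

odd-residues-valid : OddResiduesValid
odd-residues-valid = from-yes oddResiduesValid?

packing-from-valid-pattern : ∀ {t r} → 2 ≤ t → t % 16 ≡ r % 16 → ValidPattern r →
  IsSPackingColoring (DistAdj t) S₁₁₂ 4 (Periodic.colouring 16 (pattern-colour r))
packing-from-valid-pattern {t} {r} 2≤t t≡r
  (avoids₂ , avoidsᵣ , avoids₄ , avoidsᵣ₊ᵣ , avoidsᵣ₊₂ , avoidsᵣ₊₁₄) =
  packing-from-gaps 2≤t colouring
    (avoids-gap Never refl avoids₂) (avoids-gap Never t≡r avoidsᵣ) two-step
  where
  open Periodic 16 (pattern-colour r)
  open ≡-Reasoning

  t-2+16≡t+14 : t ∸ 2 + 16 ≡ t + 14
  t-2+16≡t+14 = trans (sym (+-assoc (t ∸ 2) 2 14)) (cong (_+ 14) (m∸n+n≡m 2≤t))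

  t-2≡r+14 : (t ∸ 2) % 16 ≡ (r + 14) % 16
  t-2≡r+14 = begin
    (t ∸ 2) % 16      ≡⟨ [m+n]%n≡m%n (t ∸ 2) 16 ⟨
    (t ∸ 2 + 16) % 16 ≡⟨ cong (_% 16) t-2+16≡t+14 ⟩
    (t + 14) % 16     ≡⟨ %-cong-+ t r 14 14 16 t≡r refl ⟩
    (r + 14) % 16     ∎

  t+t≡r+r : (t + t) % 16 ≡ (r + r) % 16
  t+t≡r+r = %-cong-+ t r t r 16 t≡r t≡r

  t+2≡r+2 : (t + 2) % 16 ≡ (r + 2) % 16
  t+2≡r+2 = %-cong-+ t r 2 2 16 t≡r refl

  two-step : ∀ {d} → TwoStepGap t d → AvoidsGap colouring Light d
  two-step 2+2 = avoids-gap Light refl avoids₄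
  two-step t+t = avoids-gap Light t+t≡r+r avoidsᵣ₊ᵣ
  two-step t+2 = avoids-gap Light t+2≡r+2 avoidsᵣ₊₂
  two-step t-2 = avoids-gap Light t-2≡r+14 avoidsᵣ₊₁₄

packing-with-four-colours : ∀ t → 3 ≤ t → ¬ 2 ∣ t → HasSPackingColoring (DistAdj t) S₁₁₂ 4
packing-with-four-colours t 3≤t t-odd =
  _ , packing-from-valid-pattern {r = toℕ (t mod 16)} (<⇒≤ 3≤t) t≡r
          (odd-residues-valid (t mod 16) r-odd)
  where
  toℕ-t-mod-16 : toℕ (t mod 16) ≡ t % 16
  toℕ-t-mod-16 = toℕ-fromℕ< (m%n<n t 16)
  t≡r : t % 16 ≡ toℕ (t mod 16) % 16
  t≡r = trans (sym (m%n%n≡m%n t 16)) (cong (_% 16) (sym toℕ-t-mod-16))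
  r-odd : toℕ (t mod 16) % 2 ≡ 1
  r-odd = trans (cong (_% 2) toℕ-t-mod-16)
                (trans (m∣n⇒o%n%m≡o%m 2 16 t (divides 8 refl)) (odd-remainder t-odd))

theorem2 : (t : ℕ) → 3 ≤ t → ¬ (2 ∣ t) →
    SPackingChromaticNumberIs (DistAdj t) S₁₁₂ 4
theorem2 t 3≤t t-odd = packing-with-four-colours t 3≤t t-odd , no-packing-below-four t 3≤t t-odd
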